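{- Let $\Gamma=(V,E)$ be a finite vertex-transitive graph of degree $k$, and let $a,b$ be integers with $0\le a\le k-1$ and $1\le b\le k$. If $\Gamma$ admits an $(a,b)$-perfect set $W_1$, then the multiplicity of $a-b$ as an eigenvalue of $\Gamma$ is at least $r-1$, and $r-1\ge|V|/|W_1|-1$, where $r$ is the rank in $\mathbb{C}^V$ of the set of vectors $\{\mathbf{1}_{W_1^x}:x\in\mathrm{Aut}(\Gamma)\}$, with $W_1^x$ the image of $W_1$ under the automorphism $x$.
   Context: Graphs are finite, simple and undirected. A nonempty proper subset $W_1$ of the vertex set of a $k$-regular graph is an $(a,b)$-perfect set if every vertex of $W_1$ has exactly $a$ neighbours in $W_1$ and every vertex outside $W_1$ has exactly $b$ neighbours in $W_1$. $\mathbf{1}_X$ is the characteristic vector of $X\subseteq V$. -}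

module Defs where

open import Data.Nat as ℕ using (ℕ; zero; suc)
open import Data.Fin using (Fin; zero; suc)
open import Data.Bool using (Bool; true; false; _∧_)
open import Data.Integer using (+_)
open import Data.Rational as ℚ using (ℚ; 0ℚ; 1ℚ)
open import Data.Fin.Permutation using (Permutation′; _⟨$⟩ʳ_; _⟨$⟩ˡ_)
open import Data.Product using (Σ; ∃; _×_; _,_; proj₁)
open import Function using (_∘_)
open import Relation.Binary.PropositionalEquality using (_≡_)
open import Relation.Nullary using (¬_)

sumℕ : ∀ {n} → (Fin n → ℕ) → ℕ
sumℕ {zero} f = 0
sumℕ {suc n} f = f zero ℕ.+ sumℕ (λ i → f (suc i))

sumℚ : ∀ {n} → (Fin n → ℚ) → ℚ
sumℚ {zero} f = 0ℚ
sumℚ {suc n} f = f zero ℚ.+ sumℚ (λ i → f (suc i))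

indℕ : Bool → ℕ
indℕ true = 1
indℕ false = 0

indℚ : Bool → ℚ
indℚ true = 1ℚ
indℚ false = 0ℚ

ℕ→ℚ : ℕ → ℚ
ℕ→ℚ m = + m ℚ./ 1

record Graph (n : ℕ) : Set where
  field
    adj         : Fin n → Fin n → Bool
    symmetric   : ∀ u v → adj u v ≡ adj v u
    irreflexive : ∀ v → adj v v ≡ false
open Graph public

Subset : ℕ → Set
Subset n = Fin n → Bool

card : ∀ {n} → Subset n → ℕ
card W = sumℕ (indℕ ∘ W)

neighboursIn : ∀ {n} → Graph n → Subset n → Fin n → ℕ
neighboursIn G W v = sumℕ (λ u → indℕ (adj G v u ∧ W u))

IsRegular : ∀ {n} → Graph n → ℕ → Set
IsRegular G k = ∀ v → sumℕ (λ u → indℕ (adj G v u)) ≡ k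

IsPerfectSet : ∀ {n} → Graph n → ℕ → ℕ → Subset n → Set
IsPerfectSet G a b W =
  (∃ λ v → W v ≡ true) × (∃ λ v → W v ≡ false) ×
  (∀ v → W v ≡ true → neighboursIn G W v ≡ a) ×
  (∀ v → W v ≡ false → neighboursIn G W v ≡ b)

IsAutomorphism : ∀ {n} → Graph n → Permutation′ n → Set
IsAutomorphism G π = ∀ u v → adj G (π ⟨$⟩ʳ u) (π ⟨$⟩ʳ v) ≡ adj G u v

Aut : ∀ {n} → Graph n → Set
Aut {n} G = Σ (Permutation′ n) (IsAutomorphism G)

VertexTransitive : ∀ {n} → Graph n → Set
VertexTransitive G = ∀ u v → ∃ λ (σ : Aut G) → proj₁ σ ⟨$⟩ʳ u ≡ v

-- image W^x of W under the permutation x : v ∈ W^x iff x⁻¹ v ∈ W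
image : ∀ {n} → Subset n → Permutation′ n → Subset n
image W π v = W (π ⟨$⟩ˡ v)

Vector : ℕ → Set
Vector n = Fin n → ℚ

charVec : ∀ {n} → Subset n → Vector n
charVec W = indℚ ∘ W

linComb : ∀ {m n} → (Fin m → ℚ) → (Fin m → Vector n) → Vector n
linComb c vs j = sumℚ (λ i → c i ℚ.* vs i j)

LinearlyIndependent : ∀ {m n} → (Fin m → Vector n) → Set
LinearlyIndependent vs =
  ∀ c → (∀ j → linComb c vs j ≡ 0ℚ) → ∀ i → c i ≡ 0ℚ

IsRankOf : ∀ {n} {I : Set} → (I → Vector n) → ℕ → Set
IsRankOf {n} {I} f r =
  (∃ λ (xs : Fin r → I) → LinearlyIndependent (f ∘ xs)) ×
  (∀ (xs : Fin (suc r) → I) → ¬ LinearlyIndependent (f ∘ xs))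

adjMatrix : ∀ {n} → Graph n → Fin n → Fin n → ℚ
adjMatrix G u v = indℚ (adj G u v)

mulVec : ∀ {n} → (Fin n → Fin n → ℚ) → Vector n → Vector n
mulVec A x u = sumℚ (λ v → A u v ℚ.* x v)

Eigenspace : ∀ {n} → Graph n → ℚ → Set
Eigenspace {n} G θ = Σ (Vector n) (λ x → ∀ u → mulVec (adjMatrix G) x u ≡ θ ℚ.* x u)

-- multiplicity of θ as an eigenvalue of the (symmetric) adjacency matrix
-- = dimension of the eigenspace = rank of the set of θ-eigenvectors
IsMultiplicity : ∀ {n} → Graph n → ℚ → ℕ → Set
IsMultiplicity G θ m = IsRankOf {I = Eigenspace G θ} proj₁ m

-- Every automorphic image W₁ˣ of an (a,b)-perfect set has the same neighbour counts, so
-- A 𝟏_{W₁ˣ} = (a − b) 𝟏_{W₁ˣ} + b 𝟏 and the difference of two such characteristic vectors is an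
-- (a − b)-eigenvector. Subtracting one of r independent vectors 𝟏_{W₁ˣⁱ} from the others leaves
-- r − 1 independent eigenvectors. For the second bound, the sets W₁ˣⁱ cover V: by vertex
-- transitivity every vertex j lies in some image W₁^σ, and if j lay in none of the W₁ˣⁱ, then
-- 𝟏_{W₁^σ} could be added to the family without destroying independence. Counting incidences
-- then gives |V| ≤ r |W₁|.
module Submission where

open import Defs
open import Data.Nat using (ℕ; _≤_; _<_; _∸_; _*_)
open import Data.Fin using (Fin)
open import Data.Product using (_×_; proj₁)
open import Data.Rational as ℚ using ()

open import Data.Nat as N using (zero; suc; z≤n)
import Data.Nat.Properties as NP
open import Data.Nat.Coprimality using (1-coprimeTo) renaming (sym to coprime-sym)
open import Data.Fin using (zero; suc; _↑ʳ_)
import Data.Fin.Properties as FP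
open import Data.Fin.Permutation as P using (Permutation′; _⟨$⟩ʳ_; _⟨$⟩ˡ_)
open import Data.Bool using (Bool; true; false; _∧_)
open import Data.Integer using (+_)
open import Data.Rational using (ℚ; 0ℚ; 1ℚ; mkℚ; 1/_; ≢-nonZero)
import Data.Rational.Properties as QP
open import Data.Rational.Solver using (module +-*-Solver)
open import Data.Vec.Functional using (_∷_)
open import Data.Product using (Σ; ∃; _,_)
open import Data.Empty using (⊥-elim)
open import Function using (_∘_)
open import Relation.Binary.PropositionalEquality
open import Relation.Nullary using (¬_; yes; no)
import Algebra.Properties.CommutativeMonoid.Sum as CommutativeMonoidSum

open +-*-Solver

module ℕSum = CommutativeMonoidSum NP.+-0-commutativeMonoid

sumℕ≗sum : ∀ {n} (f : Fin n → ℕ) → sumℕ f ≡ ℕSum.sum f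
sumℕ≗sum {zero} f = refl
sumℕ≗sum {suc n} f = cong (f zero N.+_) (sumℕ≗sum (f ∘ suc))

sumℕ-cong : ∀ {n} {f g : Fin n → ℕ} → (∀ i → f i ≡ g i) → sumℕ f ≡ sumℕ g
sumℕ-cong {zero} f≗g = refl
sumℕ-cong {suc n} f≗g = cong₂ N._+_ (f≗g zero) (sumℕ-cong (f≗g ∘ suc))

sumℕ-const : ∀ n c → sumℕ {n} (λ _ → c) ≡ n * c
sumℕ-const zero c = refl
sumℕ-const (suc n) c = cong (c N.+_) (sumℕ-const n c)

sumℕ-mono-≤ : ∀ {n} {f g : Fin n → ℕ} → (∀ i → f i ≤ g i) → sumℕ f ≤ sumℕ g
sumℕ-mono-≤ {zero} f≤g = z≤n
sumℕ-mono-≤ {suc n} f≤g = NP.+-mono-≤ (f≤g zero) (sumℕ-mono-≤ (f≤g ∘ suc))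

≤-sumℕ : ∀ {n} (f : Fin n → ℕ) (i : Fin n) → f i ≤ sumℕ f
≤-sumℕ f zero = NP.m≤m+n _ _
≤-sumℕ f (suc i) = NP.≤-trans (≤-sumℕ (f ∘ suc) i) (NP.m≤n+m _ _)

sumℕ-permute : ∀ {n} (f : Fin n → ℕ) (π : Permutation′ n) → sumℕ f ≡ sumℕ (f ∘ (π ⟨$⟩ʳ_))
sumℕ-permute f π = begin
  sumℕ f                    ≡⟨ sumℕ≗sum f ⟩
  ℕSum.sum f                ≡⟨ ℕSum.sum-permute f π ⟩
  ℕSum.sum (f ∘ (π ⟨$⟩ʳ_))  ≡⟨ sumℕ≗sum (f ∘ (π ⟨$⟩ʳ_)) ⟨
  sumℕ (f ∘ (π ⟨$⟩ʳ_))      ∎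
  where open ≡-Reasoning

sumℕ-swap : ∀ {m n} (f : Fin m → Fin n → ℕ) →
  sumℕ (λ i → sumℕ (f i)) ≡ sumℕ (λ j → sumℕ (λ i → f i j))
sumℕ-swap f = begin
  sumℕ (λ i → sumℕ (f i))                    ≡⟨ sumℕ-cong (sumℕ≗sum ∘ f) ⟩
  sumℕ (λ i → ℕSum.sum (f i))                ≡⟨ sumℕ≗sum (λ i → ℕSum.sum (f i)) ⟩
  ℕSum.sum (λ i → ℕSum.sum (f i))            ≡⟨ ℕSum.∑-comm f ⟩
  ℕSum.sum (λ j → ℕSum.sum (λ i → f i j))    ≡⟨ sumℕ≗sum (λ j → ℕSum.sum (λ i → f i j)) ⟨
  sumℕ (λ j → ℕSum.sum (λ i → f i j))        ≡⟨ sumℕ-cong (λ j → sumℕ≗sum (λ i → f i j)) ⟨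
  sumℕ (λ j → sumℕ (λ i → f i j))            ∎
  where open ≡-Reasoning

ℕ→ℚ-suc : ∀ m → ℕ→ℚ (suc m) ≡ 1ℚ ℚ.+ ℕ→ℚ m
ℕ→ℚ-suc zero = refl
-- The middle term normalises to (2 + m * 1) / 1, since ℚ addition normalises its result.
ℕ→ℚ-suc (suc m) = begin
  ℕ→ℚ (suc (suc m))                ≡⟨ QP./-cong {p₁ = + suc (suc m)} {q₁ = 1} (cong (λ x → + suc x) (sym (NP.*-identityʳ (suc m)))) refl ⟩
  1ℚ ℚ.+ mkℚ (+ suc m) 0 coprime   ≡⟨ cong (1ℚ ℚ.+_) (QP.normalize-coprime coprime) ⟨
  1ℚ ℚ.+ ℕ→ℚ (suc m)               ∎
  where
  open ≡-Reasoning
  coprime = coprime-sym (1-coprimeTo (suc m))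

sumℚ-cong : ∀ {n} {f g : Fin n → ℚ} → (∀ i → f i ≡ g i) → sumℚ f ≡ sumℚ g
sumℚ-cong {zero} f≗g = refl
sumℚ-cong {suc n} f≗g = cong₂ ℚ._+_ (f≗g zero) (sumℚ-cong (f≗g ∘ suc))

sumℚ-zero : ∀ {n} {f : Fin n → ℚ} → (∀ i → f i ≡ 0ℚ) → sumℚ f ≡ 0ℚ
sumℚ-zero {zero} f≗0 = refl
sumℚ-zero {suc n} f≗0 = cong₂ ℚ._+_ (f≗0 zero) (sumℚ-zero (f≗0 ∘ suc))

sumℚ-indℚ : ∀ {n} (f : Fin n → Bool) → sumℚ (indℚ ∘ f) ≡ ℕ→ℚ (sumℕ (indℕ ∘ f))
sumℚ-indℚ {zero} f = refl
sumℚ-indℚ {suc n} f with f zero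
... | true = trans (cong (1ℚ ℚ.+_) (sumℚ-indℚ (f ∘ suc))) (sym (ℕ→ℚ-suc (sumℕ (indℕ ∘ f ∘ suc))))
... | false = trans (QP.+-identityˡ _) (sumℚ-indℚ (f ∘ suc))

sumℚ-sub : ∀ {n} (f g : Fin n → ℚ) → sumℚ (λ i → f i ℚ.- g i) ≡ sumℚ f ℚ.- sumℚ g
sumℚ-sub {zero} f g = refl
sumℚ-sub {suc n} f g =
  trans (cong ((f zero ℚ.- g zero) ℚ.+_) (sumℚ-sub (f ∘ suc) (g ∘ suc)))
        (solve 4 (λ x y s t → (x :- y) :+ (s :- t) := (x :+ s) :- (y :+ t)) refl
          (f zero) (g zero) (sumℚ (f ∘ suc)) (sumℚ (g ∘ suc)))

sumℚ-*ʳ : ∀ {n} (f : Fin n → ℚ) (y : ℚ) → sumℚ (λ i → f i ℚ.* y) ≡ sumℚ f ℚ.* y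
sumℚ-*ʳ {zero} f y = sym (QP.*-zeroˡ y)
sumℚ-*ʳ {suc n} f y =
  trans (cong (f zero ℚ.* y ℚ.+_) (sumℚ-*ʳ (f ∘ suc) y)) (sym (QP.*-distribʳ-+ y (f zero) _))

*-distribˡ-sub : ∀ p q r → p ℚ.* (q ℚ.- r) ≡ p ℚ.* q ℚ.- p ℚ.* r
*-distribˡ-sub p q r =
  trans (QP.*-distribˡ-+ p q (ℚ.- r)) (cong (p ℚ.* q ℚ.+_) (sym (QP.neg-distribʳ-* p r)))

indℚ-∧ : ∀ x y → indℚ x ℚ.* indℚ y ≡ indℚ (x ∧ y)
indℚ-∧ true y = QP.*-identityˡ (indℚ y)
indℚ-∧ false y = QP.*-zeroˡ (indℚ y)

indℚ≢0⇒true : ∀ {x} → indℚ x ≢ 0ℚ → x ≡ true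
indℚ≢0⇒true {true} _ = refl
indℚ≢0⇒true {false} ind≢0 = ⊥-elim (ind≢0 refl)

true⇒indℚ≢0 : ∀ {x} → x ≡ true → indℚ x ≢ 0ℚ
true⇒indℚ≢0 refl = QP.1≢0

*-zero-cancelʳ : ∀ p {q} → q ≢ 0ℚ → p ℚ.* q ≡ 0ℚ → p ≡ 0ℚ
*-zero-cancelʳ p {q} q≢0 pq≡0 = begin
  p                       ≡⟨ QP.*-identityʳ p ⟨
  p ℚ.* 1ℚ                ≡⟨ cong (p ℚ.*_) (QP.*-inverseʳ q) ⟨
  p ℚ.* (q ℚ.* 1/ q)      ≡⟨ QP.*-assoc p q (1/ q) ⟨
  (p ℚ.* q) ℚ.* 1/ q      ≡⟨ cong (ℚ._* 1/ q) pq≡0 ⟩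
  0ℚ ℚ.* 1/ q             ≡⟨ QP.*-zeroˡ (1/ q) ⟩
  0ℚ                      ∎
  where
  open ≡-Reasoning
  instance _ = ≢-nonZero q≢0

linComb-head-zero : ∀ {r n} (c : Fin (suc r) → ℚ) (vs : Fin (suc r) → Vector n) (j : Fin n) →
  c zero ≡ 0ℚ → linComb c vs j ≡ linComb (c ∘ suc) (vs ∘ suc) j
linComb-head-zero c vs j c₀≡0 =
  trans (cong (λ c₀ → c₀ ℚ.* vs zero j ℚ.+ linComb (c ∘ suc) (vs ∘ suc) j) c₀≡0)
        (trans (cong (ℚ._+ linComb (c ∘ suc) (vs ∘ suc) j) (QP.*-zeroˡ (vs zero j)))
               (QP.+-identityˡ _))

LinearlyIndependent-tail : ∀ {r n} (vs : Fin (suc r) → Vector n) →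
  LinearlyIndependent vs → LinearlyIndependent (vs ∘ suc)
LinearlyIndependent-tail vs independent c vanish i =
  independent (0ℚ ∷ c) (λ j → trans (linComb-head-zero (0ℚ ∷ c) vs j refl) (vanish j)) (suc i)

LinearlyIndependent-↑ʳ : ∀ d {r n} (vs : Fin (d N.+ r) → Vector n) →
  LinearlyIndependent vs → LinearlyIndependent (vs ∘ (d ↑ʳ_))
LinearlyIndependent-↑ʳ zero vs independent = independent
LinearlyIndependent-↑ʳ (suc d) vs independent =
  LinearlyIndependent-↑ʳ d (vs ∘ suc) (LinearlyIndependent-tail vs independent)

-- The extended family vanishes at j except for w, which forces the new coefficient to be zero.
LinearlyIndependent-∷ : ∀ {r n} (w : Vector n) (vs : Fin r → Vector n) (j : Fin n) →
  w j ≢ 0ℚ → (∀ i → vs i j ≡ 0ℚ) → LinearlyIndependent vs → LinearlyIndependent (w ∷ vs)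
LinearlyIndependent-∷ w vs j wⱼ≢0 vsⱼ≡0 independent c vanish = coefficients
  where
  c₀≡0 : c zero ≡ 0ℚ
  c₀≡0 = *-zero-cancelʳ (c zero) wⱼ≢0 (begin
    c zero ℚ.* w j                                  ≡⟨ QP.+-identityʳ _ ⟨
    c zero ℚ.* w j ℚ.+ 0ℚ                           ≡⟨ cong (c zero ℚ.* w j ℚ.+_) (sumℚ-zero (λ i →
                                                         trans (cong (c (suc i) ℚ.*_) (vsⱼ≡0 i)) (QP.*-zeroʳ (c (suc i))))) ⟨
    linComb c (w ∷ vs) j                            ≡⟨ vanish j ⟩
    0ℚ                                              ∎)
    where open ≡-Reasoning
  coefficients : ∀ i → c i ≡ 0ℚ
  coefficients zero = c₀≡0
  coefficients (suc i) =
    independent (c ∘ suc) (λ j′ → trans (sym (linComb-head-zero c (w ∷ vs) j′ c₀≡0)) (vanish j′)) i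

LinearlyIndependent-differences : ∀ {r n} (vs : Fin (suc r) → Vector n) →
  LinearlyIndependent vs → LinearlyIndependent (λ i j → vs (suc i) j ℚ.- vs zero j)
LinearlyIndependent-differences vs independent c vanish i = independent c′ vanish′ (suc i)
  where
  c′ : Fin _ → ℚ
  c′ = ℚ.- sumℚ c ∷ c
  vanish′ : ∀ j → linComb c′ vs j ≡ 0ℚ
  vanish′ j = begin
    ℚ.- sumℚ c ℚ.* vs zero j ℚ.+ linComb c (vs ∘ suc) j
      ≡⟨ solve 3 (λ s x t → (:- s) :* x :+ t := t :- s :* x) refl (sumℚ c) (vs zero j) (linComb c (vs ∘ suc) j) ⟩
    linComb c (vs ∘ suc) j ℚ.- sumℚ c ℚ.* vs zero j
      ≡⟨ cong (λ s → linComb c (vs ∘ suc) j ℚ.- s) (sumℚ-*ʳ c (vs zero j)) ⟨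
    linComb c (vs ∘ suc) j ℚ.- sumℚ (λ i → c i ℚ.* vs zero j)
      ≡⟨ sumℚ-sub (λ i → c i ℚ.* vs (suc i) j) (λ i → c i ℚ.* vs zero j) ⟨
    sumℚ (λ i → c i ℚ.* vs (suc i) j ℚ.- c i ℚ.* vs zero j)
      ≡⟨ sumℚ-cong (λ i → *-distribˡ-sub (c i) (vs (suc i) j) (vs zero j)) ⟨
    sumℚ (λ i → c i ℚ.* (vs (suc i) j ℚ.- vs zero j))
      ≡⟨ vanish j ⟩
    0ℚ ∎
    where open ≡-Reasoning

independent⇒≤ : ∀ {n r m} {I : Set} (f : I → Vector n) →
  (∀ (ys : Fin (suc m) → I) → ¬ LinearlyIndependent (f ∘ ys)) →
  (xs : Fin r → I) → LinearlyIndependent (f ∘ xs) → r ≤ m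
independent⇒≤ {r = r} {m} f maximal xs independent with r N.≤? m
... | yes r≤m = r≤m
... | no r≰m with NP.m≤n⇒∃[o]m+o≡n (NP.≰⇒> r≰m)
...   | d , m+1+d≡r with trans (NP.+-comm d (suc m)) m+1+d≡r
...     | refl = ⊥-elim (maximal (xs ∘ (d ↑ʳ_)) (LinearlyIndependent-↑ʳ d (f ∘ xs) independent))

module _ {n : ℕ} {I : Set} (f : I → Vector n) where

  maximal-independent-covers-support : ∀ {r} → (∀ (ys : Fin (suc r) → I) → ¬ LinearlyIndependent (f ∘ ys)) →
    (xs : Fin r → I) → LinearlyIndependent (f ∘ xs) →
    ∀ y j → f y j ≢ 0ℚ → ∃ λ i → f (xs i) j ≢ 0ℚ
  maximal-independent-covers-support {r} maximal xs independent y j fyⱼ≢0 =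
    FP.¬∀⟶∃¬ r (λ i → f (xs i) j ≡ 0ℚ) (λ i → f (xs i) j QP.≟ 0ℚ)
      (λ vanish → maximal (y ∷ xs) (LinearlyIndependent-∷ (f y) (f ∘ xs) j fyⱼ≢0 vanish independent))

  rank∸1≤-of-differences : ∀ {r m} {P : Vector n → Set} →
    (∀ x y → P (λ j → f x j ℚ.- f y j)) →
    (xs : Fin r → I) → LinearlyIndependent (f ∘ xs) →
    (∀ (ys : Fin (suc m) → Σ (Vector n) P) → ¬ LinearlyIndependent (proj₁ ∘ ys)) → r ∸ 1 ≤ m
  rank∸1≤-of-differences {zero} _ _ _ _ = z≤n
  rank∸1≤-of-differences {suc r} closed xs independent maximal =
    independent⇒≤ proj₁ maximal (λ i → _ , closed (xs (suc i)) (xs zero))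
      (LinearlyIndependent-differences (f ∘ xs) independent)

card-cover : ∀ {n r} (S : Fin r → Subset n) → (∀ j → ∃ λ i → S i j ≡ true) →
  n ≤ sumℕ (λ i → card (S i))
card-cover {n} S covered = begin
  n                                        ≡⟨ NP.*-identityʳ n ⟨
  n * 1                                    ≡⟨ sumℕ-const n 1 ⟨
  sumℕ {n} (λ _ → 1)                       ≤⟨ sumℕ-mono-≤ one≤covering ⟩
  sumℕ (λ j → sumℕ (λ i → indℕ (S i j)))   ≡⟨ sumℕ-swap (λ i j → indℕ (S i j)) ⟨
  sumℕ (λ i → card (S i))                  ∎
  where
  open NP.≤-Reasoning
  one≤covering : ∀ j → 1 ≤ sumℕ (λ i → indℕ (S i j))
  one≤covering j with covered j
  ... | i , Sᵢⱼ = NP.≤-trans (NP.≤-reflexive (cong indℕ (sym Sᵢⱼ))) (≤-sumℕ (λ i → indℕ (S i j)) i)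

card-image : ∀ {n} (W : Subset n) (π : Permutation′ n) → card (image W π) ≡ card W
card-image W π = sym (sumℕ-permute (indℕ ∘ W) (P.flip π))

image-∋ : ∀ {n} (W : Subset n) (π : Permutation′ n) {u v} → π ⟨$⟩ʳ u ≡ v → image W π v ≡ W u
image-∋ W π refl = cong W (P.inverseˡ π)

mulVec-sub : ∀ {n} (A : Fin n → Fin n → ℚ) (x y : Vector n) (u : Fin n) →
  mulVec A (λ v → x v ℚ.- y v) u ≡ mulVec A x u ℚ.- mulVec A y u
mulVec-sub A x y u =
  trans (sumℚ-cong (λ v → *-distribˡ-sub (A u v) (x v) (y v)))
        (sumℚ-sub (λ v → A u v ℚ.* x v) (λ v → A u v ℚ.* y v))

HasNeighbourCounts : ∀ {n} → Graph n → ℕ → ℕ → Subset n → Set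
HasNeighbourCounts G a b W =
  (∀ v → W v ≡ true → neighboursIn G W v ≡ a) × (∀ v → W v ≡ false → neighboursIn G W v ≡ b)

module _ {n : ℕ} (G : Graph n) where

  adj-⟨$⟩ˡ : (σ : Aut G) → ∀ u v → adj G u (proj₁ σ ⟨$⟩ʳ v) ≡ adj G (proj₁ σ ⟨$⟩ˡ u) v
  adj-⟨$⟩ˡ (π , automorphism) u v =
    trans (cong (λ w → adj G w (π ⟨$⟩ʳ v)) (sym (P.inverseʳ π))) (automorphism (π ⟨$⟩ˡ u) v)

  neighboursIn-image : (σ : Aut G) (W : Subset n) (v : Fin n) →
    neighboursIn G (image W (proj₁ σ)) v ≡ neighboursIn G W (proj₁ σ ⟨$⟩ˡ v)
  neighboursIn-image σ@(π , _) W v =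
    trans (sumℕ-permute _ π)
          (sumℕ-cong (λ u → cong₂ (λ x y → indℕ (x ∧ y)) (adj-⟨$⟩ˡ σ v u) (cong W (P.inverseˡ π))))

  image-HasNeighbourCounts : ∀ {a b} (σ : Aut G) {W : Subset n} →
    HasNeighbourCounts G a b W → HasNeighbourCounts G a b (image W (proj₁ σ))
  image-HasNeighbourCounts σ {W} (inside , outside) =
    (λ v v∈ → trans (neighboursIn-image σ W v) (inside _ v∈)) ,
    (λ v v∉ → trans (neighboursIn-image σ W v) (outside _ v∉))

  mulVec-charVec : (W : Subset n) (u : Fin n) → mulVec (adjMatrix G) (charVec W) u ≡ ℕ→ℚ (neighboursIn G W u)
  mulVec-charVec W u = trans (sumℚ-cong (λ v → indℚ-∧ (adj G u v) (W v))) (sumℚ-indℚ (λ v → adj G u v ∧ W v))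

  charVec-affine-eigen : ∀ {a b} {W : Subset n} → HasNeighbourCounts G a b W → ∀ u →
    mulVec (adjMatrix G) (charVec W) u ≡ (ℕ→ℚ a ℚ.- ℕ→ℚ b) ℚ.* charVec W u ℚ.+ ℕ→ℚ b
  charVec-affine-eigen {a} {b} {W} (inside , outside) u with W u in Wᵤ
  ... | true = trans (mulVec-charVec W u) (trans (cong ℕ→ℚ (inside u Wᵤ))
      (solve 2 (λ x y → x := (x :- y) :* con 1ℚ :+ y) refl (ℕ→ℚ a) (ℕ→ℚ b)))
  ... | false = trans (mulVec-charVec W u) (trans (cong ℕ→ℚ (outside u Wᵤ))
      (solve 2 (λ x y → y := (x :- y) :* con 0ℚ :+ y) refl (ℕ→ℚ a) (ℕ→ℚ b)))

  charVec-difference-eigen : ∀ {a b} {W W′ : Subset n} →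
    HasNeighbourCounts G a b W → HasNeighbourCounts G a b W′ → ∀ u →
    mulVec (adjMatrix G) (λ v → charVec W v ℚ.- charVec W′ v) u
      ≡ (ℕ→ℚ a ℚ.- ℕ→ℚ b) ℚ.* (charVec W u ℚ.- charVec W′ u)
  charVec-difference-eigen {a} {b} {W} {W′} counts counts′ u = begin
    mulVec A (λ v → charVec W v ℚ.- charVec W′ v) u
      ≡⟨ mulVec-sub A (charVec W) (charVec W′) u ⟩
    mulVec A (charVec W) u ℚ.- mulVec A (charVec W′) u
      ≡⟨ cong₂ ℚ._-_ (charVec-affine-eigen counts u) (charVec-affine-eigen counts′ u) ⟩
    (θ ℚ.* charVec W u ℚ.+ ℕ→ℚ b) ℚ.- (θ ℚ.* charVec W′ u ℚ.+ ℕ→ℚ b)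
      ≡⟨ solve 4 (λ t p q β → (t :* p :+ β) :- (t :* q :+ β) := t :* (p :- q)) refl
           θ (charVec W u) (charVec W′ u) (ℕ→ℚ b) ⟩
    θ ℚ.* (charVec W u ℚ.- charVec W′ u) ∎
    where
    open ≡-Reasoning
    A = adjMatrix G
    θ = ℕ→ℚ a ℚ.- ℕ→ℚ b

theorem4p1 : ∀ {n k a b : ℕ} (G : Graph n) → IsRegular G k → VertexTransitive G →
    a < k → 1 ≤ b → b ≤ k →
    (W₁ : Subset n) → IsPerfectSet G a b W₁ →
    (r : ℕ) → IsRankOf (λ (x : Aut G) → charVec (image W₁ (proj₁ x))) r →
    (∀ m → IsMultiplicity G (ℕ→ℚ a ℚ.- ℕ→ℚ b) m → r ∸ 1 ≤ m) × (n ≤ r * card W₁)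
theorem4p1 {n} {a = a} {b} G _ transitive _ _ _ W ((v , v∈W) , _ , inside , outside) r ((xs , independent) , maximal) =
  (λ m (_ , maximalEigen) → rank∸1≤-of-differences indicator differences-eigen xs independent maximalEigen) ,
  (begin
    n                                            ≤⟨ card-cover (λ i → image W (proj₁ (xs i))) covered ⟩
    sumℕ (λ i → card (image W (proj₁ (xs i))))   ≡⟨ sumℕ-cong (λ i → card-image W (proj₁ (xs i))) ⟩
    sumℕ {r} (λ _ → card W)                      ≡⟨ sumℕ-const r (card W) ⟩
    r * card W                                   ∎)
  where
  open NP.≤-Reasoning
  indicator : Aut G → Vector n
  indicator x = charVec (image W (proj₁ x))
  differences-eigen : ∀ x y u → mulVec (adjMatrix G) (λ j → indicator x j ℚ.- indicator y j) u
                                  ≡ (ℕ→ℚ a ℚ.- ℕ→ℚ b) ℚ.* (indicator x u ℚ.- indicator y u)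
  differences-eigen x y = charVec-difference-eigen G (image-HasNeighbourCounts G x (inside , outside))
                                                     (image-HasNeighbourCounts G y (inside , outside))
  covered : ∀ j → ∃ λ i → image W (proj₁ (xs i)) j ≡ true
  covered j with transitive v j
  ... | σ , σv≡j with maximal-independent-covers-support indicator maximal xs independent σ j
                        (true⇒indℚ≢0 (trans (image-∋ W (proj₁ σ) σv≡j) v∈W))
  ...   | i , nonzero = i , indℚ≢0⇒true nonzero
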